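{- For every finite poset $P$, $m(P)\le \perp(P)$, where $\perp(P)=|P|+\binom{|P|}{2}-|E(CG(P))|$, i.e. $|P|$ plus the number of unordered pairs of incomparable elements of $P$.
   Context: All posets are finite. The comparability graph $CG(P)$ has vertex set $P$ with $x,y$ adjacent iff they are comparable. A copy of $P$ in $Q$ is a subset of $Q$ which with the induced order is isomorphic to $P$. A coloring of a poset is proper if comparable distinct elements get distinct colors; a copy is rainbow if its elements get pairwise distinct colors; $Q$ rainbow forces $P$ if every proper coloring of $Q$ admits a rainbow copy of $P$. $M(P)$ is the set of posets $Q$ that rainbow force $P$ but such that $Q\setminus\{q\}$ does not rainbow force $P$ for any $q\in Q$, and $m(P)$ is the minimum size of a poset in $M(P)$. -}

module Defs where

open import Data.Nat using (ℕ; zero; suc; _+_; _<ᵇ_)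
open import Data.Fin using (Fin; toℕ; punchIn)
open import Data.Fin.Properties using (punchIn-injective)
open import Data.Bool using (Bool; true; false; T; not; _∨_; _∧_; if_then_else_)
open import Data.List using (List; map; allFin)
open import Data.Nat.ListAction using (sum)
open import Data.Product using (Σ; _×_; _,_)
open import Data.Sum using (_⊎_)
open import Relation.Binary.PropositionalEquality using (_≡_)
open import Relation.Nullary using (¬_)
open import Function using (_∘_)
open import Function.Definitions using (Injective)

record FinPoset (n : ℕ) : Set where
  field
    le      : Fin n → Fin n → Bool
    refl≤   : ∀ x → T (le x x)
    antisym : ∀ x y → T (le x y) → T (le y x) → x ≡ y
    trans≤  : ∀ x y z → T (le x y) → T (le y z) → T (le x z)
open FinPoset public

Comparable : ∀ {n} → FinPoset n → Fin n → Fin n → Set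
Comparable P x y = T (le P x y) ⊎ T (le P y x)

Coloring : ℕ → Set
Coloring n = Fin n → ℕ

Proper : ∀ {n} → FinPoset n → Coloring n → Set
Proper Q c = ∀ x y → ¬ (x ≡ y) → Comparable Q x y → ¬ (c x ≡ c y)

-- An order embedding P → Q; its image is exactly a copy of P in Q.
IsEmbedding : ∀ {k n} → FinPoset k → FinPoset n → (Fin k → Fin n) → Set
IsEmbedding P Q f =
  Injective _≡_ _≡_ f × (∀ x y → (T (le P x y) → T (le Q (f x) (f y)))
                               × (T (le Q (f x) (f y)) → T (le P x y)))

HasRainbowCopy : ∀ {k n} → FinPoset k → FinPoset n → Coloring n → Set
HasRainbowCopy P Q c =
  Σ (Fin _ → Fin _) λ f → IsEmbedding P Q f × Injective _≡_ _≡_ (c ∘ f)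

RainbowForces : ∀ {n k} → FinPoset n → FinPoset k → Set
RainbowForces Q P = ∀ (c : Coloring _) → Proper Q c → HasRainbowCopy P Q c

Delete : ∀ {n} → FinPoset (suc n) → Fin (suc n) → FinPoset n
Delete Q q = record
  { le      = λ x y → le Q (punchIn q x) (punchIn q y)
  ; refl≤   = λ x → refl≤ Q (punchIn q x)
  ; antisym = λ x y p r → punchIn-injective q x y (antisym Q _ _ p r)
  ; trans≤  = λ x y z p r → trans≤ Q _ _ _ p r
  }

NoDeletionForces : ∀ {k} (n : ℕ) → FinPoset n → FinPoset k → Set
NoDeletionForces zero    Q P = Data.Unit.⊤
  where import Data.Unit
NoDeletionForces (suc n) Q P = ∀ q → ¬ RainbowForces (Delete Q q) P

InM : ∀ {n k} → FinPoset n → FinPoset k → Set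
InM {n} Q P = RainbowForces Q P × NoDeletionForces n Q P

incompB : ∀ {n} → FinPoset n → Fin n → Fin n → Bool
incompB P x y = not (le P x y ∨ le P y x)

incompPairs : ∀ {n} → FinPoset n → ℕ
incompPairs {n} P =
  sum (map (λ i → sum (map (λ j →
    if (toℕ i <ᵇ toℕ j) ∧ incompB P i j then 1 else 0) (allFin n))) (allFin n))

perp : ∀ {n} → FinPoset n → ℕ
perp {n} P = n + incompPairs P

-- Blow up P by replacing each element j with a chain of 1 + e(j) elements, where e(j) is
-- the number of elements after j (in the enumeration Fin k) incomparable to j; this
-- poset has exactly ⊥(P) elements. A proper colouring makes every chain rainbow. Choosing
-- one element per chain, from the last element of P backwards, the chain over j always
-- has an element whose colour avoids the e(j) colours already chosen for the later
-- elements incomparable to j; comparable choices are comparable in the blow-up, hence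
-- differently coloured. So the chosen elements form a rainbow copy of P. Rainbow forcing
-- is decidable (only the kernel of a colouring matters), so deleting points while forcing
-- persists ends in a member of M(P) no larger than the blow-up.
module Submission where

open import Defs
import Data.Nat.Properties as NP
open import Algebra.Properties.CommutativeMonoid.Sum NP.+-0-commutativeMonoid
  using (∑-distrib-+; sum-cong-≗) renaming (sum to ∑)
open import Data.Bool using (Bool; true; false; T; not; _∨_; _∧_; if_then_else_)
open import Data.Bool.Properties using (T?; T-∧)
open import Data.Empty using (⊥-elim)
open import Data.Fin as Fin
  using (Fin; zero; suc; toℕ; _↑ˡ_; _↑ʳ_; splitAt; punchIn; finToFun; funToFin)
open import Data.Fin.Properties as FinP using (any?; all?; ∀-cons; finToFun-funToFin)
open import Data.List using (map; allFin; tabulate)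
open import Data.List.Properties using (map-tabulate)
open import Data.Nat
  using (ℕ; zero; suc; _+_; _^_; _≤_; _<_; _≤ᵇ_; _<ᵇ_; z≤n; s≤s⁻¹; s<s⁻¹)
open import Data.Nat.ListAction using (sum)
open import Data.Product as Product using (Σ; _×_; _,_; proj₁; proj₂; ∃; map₂)
open import Data.Sum as Sum using (_⊎_; inj₁; inj₂; swap)
open import Data.Unit using (tt)
open import Function using (_∘_; _⇔_; mk⇔; Equivalence)
open import Function.Definitions using (Injective)
open import Relation.Binary.Definitions using (DecidableEquality; tri<; tri≈; tri>)
open import Relation.Binary.PropositionalEquality
open import Relation.Nullary using (Dec; yes; no; ¬_)
open import Relation.Nullary.Decidable using (map′; _→-dec_; _×-dec_; _⊎-dec_; ¬?)

open Equivalence using (to; from)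

count : ∀ {n} → (Fin n → Bool) → ℕ
count p = ∑ (λ i → if p i then 1 else 0)

∑-ones : ∀ n → ∑ {n} (λ _ → 1) ≡ n
∑-ones zero    = refl
∑-ones (suc n) = cong suc (∑-ones n)

∑-suc : ∀ {n} (f : Fin n → ℕ) → ∑ (λ i → suc (f i)) ≡ n + ∑ f
∑-suc {n} f = trans (∑-distrib-+ (λ _ → 1) f) (cong (_+ ∑ f) (∑-ones n))

sum-tabulate : ∀ {n} (f : Fin n → ℕ) → sum (tabulate f) ≡ ∑ f
sum-tabulate {zero}  f = refl
sum-tabulate {suc n} f = cong (f zero +_) (sum-tabulate (f ∘ suc))

sum-map-allFin : ∀ {n} (f : Fin n → ℕ) → sum (map f (allFin n)) ≡ ∑ f
sum-map-allFin {n} f = trans (cong sum (map-tabulate (λ i → i) f)) (sum-tabulate f)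

block : ∀ {n} (f : Fin n → ℕ) → Fin (∑ f) → Fin n
block {suc n} f x with splitAt (f zero) x
... | inj₁ _ = zero
... | inj₂ y = suc (block (f ∘ suc) y)

inBlock : ∀ {n} (f : Fin n → ℕ) (j : Fin n) → Fin (f j) → Fin (∑ f)
inBlock {suc n} f zero    a = a ↑ˡ ∑ (f ∘ suc)
inBlock {suc n} f (suc j) a = f zero ↑ʳ inBlock (f ∘ suc) j a

block-inBlock : ∀ {n} (f : Fin n → ℕ) j a → block f (inBlock f j a) ≡ j
block-inBlock {suc n} f zero a
  rewrite FinP.splitAt-↑ˡ (f zero) a (∑ (f ∘ suc)) = refl
block-inBlock {suc n} f (suc j) a
  rewrite FinP.splitAt-↑ʳ (f zero) (∑ (f ∘ suc)) (inBlock (f ∘ suc) j a)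
  = cong suc (block-inBlock (f ∘ suc) j a)

inBlock-injective : ∀ {n} (f : Fin n → ℕ) j → Injective _≡_ _≡_ (inBlock f j)
inBlock-injective {suc n} f zero    = FinP.↑ˡ-injective _ _ _
inBlock-injective {suc n} f (suc j) =
  inBlock-injective (f ∘ suc) j ∘ FinP.↑ʳ-injective (f zero) _ _

_⇒ᵇ_ : Bool → Bool → Bool
p ⇒ᵇ q = not p ∨ q

T-⇒ᵇ : ∀ {p q} → T (p ⇒ᵇ q) ⇔ (T p → T q)
T-⇒ᵇ {false} = mk⇔ (λ _ ()) (λ _ → tt)
T-⇒ᵇ {true}  = mk⇔ (λ q _ → q) (λ f → f tt)

module _ {m n} (P : FinPoset n) (o : Fin m → Fin n) where

  -- Given the first conjunct, the guard le P (o y) (o x) holds exactly when o x ≡ o y, so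
  -- each fibre of o becomes a chain ordered as in Fin m.
  lexᵇ : Fin m → Fin m → Bool
  lexᵇ x y = le P (o x) (o y) ∧ (le P (o y) (o x) ⇒ᵇ (toℕ x ≤ᵇ toℕ y))

  lex-intro : ∀ {x y} → T (le P (o x) (o y)) → (T (le P (o y) (o x)) → toℕ x ≤ toℕ y) →
              T (lexᵇ x y)
  lex-intro below tie = from T-∧ (below , from T-⇒ᵇ (NP.≤⇒≤ᵇ ∘ tie))

  lex-below : ∀ {x y} → T (lexᵇ x y) → T (le P (o x) (o y))
  lex-below = proj₁ ∘ to T-∧

  lex-tie : ∀ {x y} → T (lexᵇ x y) → T (le P (o y) (o x)) → toℕ x ≤ toℕ y
  lex-tie {x} {y} x≤y = NP.≤ᵇ⇒≤ (toℕ x) (toℕ y) ∘ to T-⇒ᵇ (proj₂ (to T-∧ x≤y))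

  lexSum : FinPoset m
  lexSum = record
    { le      = lexᵇ
    ; refl≤   = λ x → lex-intro (refl≤ P (o x)) (λ _ → NP.≤-refl)
    ; antisym = λ x y x≤y y≤x → FinP.toℕ-injective
                  (NP.≤-antisym (lex-tie x≤y (lex-below y≤x)) (lex-tie y≤x (lex-below x≤y)))
    ; trans≤  = λ x y z x≤y y≤z →
                  lex-intro (trans≤ P _ _ _ (lex-below x≤y) (lex-below y≤z))
                  (λ z≤x → NP.≤-trans
                    (lex-tie x≤y (trans≤ P _ _ _ (lex-below y≤z) z≤x))
                    (lex-tie y≤z (trans≤ P _ _ _ z≤x (lex-below x≤y))))
    }

  lexSum-sameFibre-comparable : ∀ {x y} → o x ≡ o y → Comparable lexSum x y
  lexSum-sameFibre-comparable {x} {y} ox≡oy with NP.≤-total (toℕ x) (toℕ y)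
  ... | inj₁ x≤y = inj₁ (lex-intro ox≤oy λ _ → x≤y)
    where ox≤oy = subst (T ∘ le P (o x)) ox≡oy (refl≤ P (o x))
  ... | inj₂ y≤x = inj₂ (lex-intro oy≤ox λ _ → y≤x)
    where oy≤ox = subst (T ∘ le P (o y)) (sym ox≡oy) (refl≤ P (o y))

  lexSum-section-embedding : (r : Fin n → Fin m) → (∀ i → o (r i) ≡ i) →
                             IsEmbedding P lexSum r
  lexSum-section-embedding r or≡ = r-injective , λ x y → preserve x y , reflect x y
    where
    le-r : ∀ {x y} → T (le P x y) → T (le P (o (r x)) (o (r y)))
    le-r {x} {y} = subst₂ (λ a b → T (le P a b)) (sym (or≡ x)) (sym (or≡ y))

    r-injective : Injective _≡_ _≡_ r
    r-injective {x} {y} rx≡ry = trans (sym (or≡ x)) (trans (cong o rx≡ry) (or≡ y))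

    preserve : ∀ x y → T (le P x y) → T (lexᵇ (r x) (r y))
    preserve x y x≤y = lex-intro (le-r x≤y) λ ry≤rx → NP.≤-reflexive (cong (toℕ ∘ r)
      (antisym P x y x≤y (subst₂ (λ a b → T (le P a b)) (or≡ y) (or≡ x) ry≤rx)))

    reflect : ∀ x y → T (lexᵇ (r x) (r y)) → T (le P x y)
    reflect x y = subst₂ (λ a b → T (le P a b)) (or≡ x) (or≡ y) ∘ lex-below

∃-avoiding : ∀ {s n} (g : Fin s → ℕ) → Injective _≡_ _≡_ g →
             (p : Fin n → Bool) (F : Fin n → ℕ) → count p < s →
             ∃ λ a → ∀ i → T (p i) → g a ≢ F i
∃-avoiding {zero}  g g-inj p F ()
∃-avoiding {suc s} {zero}  g g-inj p F bound = zero , λ ()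
∃-avoiding {suc s} {suc n} g g-inj p F bound with p zero in p₀≡
... | false = map₂ (∀-cons (λ p₀ → ⊥-elim (subst T p₀≡ p₀)))
                   (∃-avoiding g g-inj (p ∘ suc) (F ∘ suc) bound)
... | true with any? (λ a → g a NP.≟ F zero)
...   | no  none = map₂ (λ {a} → ∀-cons (λ _ ga≡F₀ → none (a , ga≡F₀)))
                        (∃-avoiding g g-inj (p ∘ suc) (F ∘ suc) (NP.<⇒≤ bound))
...   | yes (a₀ , ga₀≡F₀) =   -- a₀ is the only element coloured F zero; drop it and recurse
  Product.map (punchIn a₀)
    (λ {a} → ∀-cons λ _ ga≡F₀ →
       FinP.punchInᵢ≢i a₀ a (g-inj (trans ga≡F₀ (sym ga₀≡F₀))))
    (∃-avoiding (g ∘ punchIn a₀) (FinP.punchIn-injective a₀ _ _ ∘ g-inj)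
       (p ∘ suc) (F ∘ suc) (s≤s⁻¹ bound))

DistinctOn : ∀ {n} (B : Fin n → Fin n → Bool) {s : Fin n → ℕ} →
             (∀ j → Fin (s j) → ℕ) → ((j : Fin n) → Fin (s j)) → Set
DistinctOn B colour choice =
  ∀ {j i} → j Fin.< i → T (B j i) → colour j (choice j) ≢ colour i (choice i)

greedy-choice : ∀ {n} (B : Fin n → Fin n → Bool) (s : Fin n → ℕ)
  (colour : ∀ j → Fin (s j) → ℕ) →
  (∀ j → Injective _≡_ _≡_ (colour j)) → (∀ j → count (B j) < s j) →
  Σ ((j : Fin n) → Fin (s j)) (DistinctOn B colour)
greedy-choice {zero}  B s colour colour-inj bound = (λ ()) , λ { {()} }
greedy-choice {suc n} B s colour colour-inj bound = choice , distinct
  where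
  later : Σ ((j : Fin n) → Fin (s (suc j)))
            (DistinctOn (λ j i → B (suc j) (suc i)) (colour ∘ suc))
  later = greedy-choice (λ j i → B (suc j) (suc i)) (s ∘ suc) (colour ∘ suc) (colour-inj ∘ suc)
            (λ j → NP.≤-<-trans (NP.m≤n+m _ _) (bound (suc j)))

  first : ∃ λ a → ∀ i → T (B zero (suc i)) → colour zero a ≢ colour (suc i) (proj₁ later i)
  first = ∃-avoiding (colour zero) (colour-inj zero) (B zero ∘ suc)
            (λ i → colour (suc i) (proj₁ later i)) (NP.≤-<-trans (NP.m≤n+m _ _) (bound zero))

  choice : (j : Fin (suc n)) → Fin (s j)
  choice zero    = proj₁ first
  choice (suc j) = proj₁ later j

  distinct : DistinctOn B colour choice
  distinct {zero}  {suc i} _   = proj₂ first i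
  distinct {suc j} {suc i} j<i = proj₂ later (s<s⁻¹ j<i)

comparable? : ∀ {n} (P : FinPoset n) x y → Dec (Comparable P x y)
comparable? P x y = T? (le P x y) ⊎-dec T? (le P y x)

T-not-∨ : ∀ p q → ¬ (T p ⊎ T q) → T (not (p ∨ q))
T-not-∨ false false _  = tt
T-not-∨ false true  ¬t = ¬t (inj₂ tt)
T-not-∨ true  _     ¬t = ¬t (inj₁ tt)

embedding-comparable : ∀ {k N} {P : FinPoset k} {Q : FinPoset N} {f} → IsEmbedding P Q f →
  ∀ {x y} → Comparable P x y → Comparable Q (f x) (f y)
embedding-comparable (_ , order) {x} {y} = Sum.map (proj₁ (order x y)) (proj₁ (order y x))

proper-injective-on-chain : ∀ {s N} (Q : FinPoset N) {c : Coloring N} → Proper Q c →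
  (h : Fin s → Fin N) → Injective _≡_ _≡_ h → (∀ a b → Comparable Q (h a) (h b)) →
  Injective _≡_ _≡_ (c ∘ h)
proper-injective-on-chain Q c-proper h h-inj chain {a} {b} cha≡chb with a Fin.≟ b
... | yes a≡b = a≡b
... | no  a≢b = ⊥-elim (c-proper (h a) (h b) (a≢b ∘ h-inj) (chain a b) cha≡chb)

module Blowup {n} (P : FinPoset n) where

  laterIncomparable : Fin n → Fin n → Bool
  laterIncomparable j i = (toℕ j <ᵇ toℕ i) ∧ incompB P j i

  laterIncomparable-intro : ∀ {j i} → j Fin.< i → ¬ Comparable P j i →
                            T (laterIncomparable j i)
  laterIncomparable-intro {j} {i} j<i j≁i =
    from T-∧ (NP.<⇒<ᵇ j<i , T-not-∨ (le P j i) (le P i j) j≁i)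

  blockSize : Fin n → ℕ
  blockSize j = suc (count (laterIncomparable j))

  size : ℕ
  size = ∑ blockSize

  Q : FinPoset size
  Q = lexSum P (block blockSize)

  size≡perp : size ≡ perp P
  size≡perp = begin
    ∑ blockSize                               ≡⟨ ∑-suc (count ∘ laterIncomparable) ⟩
    n + ∑ (count ∘ laterIncomparable)          ≡⟨ cong (n +_) rows ⟩
    n + incompPairs P                          ∎
    where
    open ≡-Reasoning
    indicator : Fin n → Fin n → ℕ
    indicator j i = if laterIncomparable j i then 1 else 0

    rows : ∑ (count ∘ laterIncomparable) ≡ incompPairs P
    rows = sym (trans (sum-map-allFin (λ j → sum (map (indicator j) (allFin n))))
                      (sum-cong-≗ (λ j → sum-map-allFin (indicator j))))

  forces : RainbowForces Q P
  forces c c-proper = r , r-embedding , c∘r-injective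
    where
    colour : (j : Fin n) → Fin (blockSize j) → ℕ
    colour j = c ∘ inBlock blockSize j

    colour-injective : ∀ j → Injective _≡_ _≡_ (colour j)
    colour-injective j = proper-injective-on-chain Q c-proper (inBlock blockSize j)
      (inBlock-injective blockSize j)
      (λ a b → lexSum-sameFibre-comparable P (block blockSize)
                 (trans (block-inBlock blockSize j a) (sym (block-inBlock blockSize j b))))

    chosen : Σ ((j : Fin n) → Fin (blockSize j)) (DistinctOn laterIncomparable colour)
    chosen = greedy-choice laterIncomparable blockSize colour colour-injective (λ j → NP.n<1+n _)

    r : Fin n → Fin size
    r j = inBlock blockSize j (proj₁ chosen j)

    r-embedding : IsEmbedding P Q r
    r-embedding = lexSum-section-embedding P (block blockSize) r
                    (λ j → block-inBlock blockSize j (proj₁ chosen j))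

    c∘r-injective : Injective _≡_ _≡_ (c ∘ r)
    c∘r-injective {x} {y} crx≡cry with x Fin.≟ y
    ... | yes x≡y = x≡y
    ... | no  x≢y with comparable? P x y
    ...   | yes x∼y = ⊥-elim (c-proper (r x) (r y) (x≢y ∘ proj₁ r-embedding)
                               (embedding-comparable {P = P} {Q = Q} r-embedding x∼y) crx≡cry)
    ...   | no  x≁y with FinP.<-cmp x y
    ...     | tri< x<y _ _ = ⊥-elim (proj₂ chosen x<y (laterIncomparable-intro x<y x≁y) crx≡cry)
    ...     | tri≈ _ x≡y _ = ⊥-elim (x≢y x≡y)
    ...     | tri> _ _ y<x =
      ⊥-elim (proj₂ chosen y<x (laterIncomparable-intro y<x (x≁y ∘ swap)) (sym crx≡cry))

injective? : ∀ {A : Set} {m} → DecidableEquality A → (f : Fin m → A) →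
             Dec (Injective _≡_ _≡_ f)
injective? _≟_ f = map′ (λ inj → inj _ _) (λ inj _ _ → inj)
  (all? λ x → all? λ y → f x ≟ f y →-dec x Fin.≟ y)

injective-resp-≗ : ∀ {A B : Set} {f g : A → B} → f ≗ g →
                   Injective _≡_ _≡_ f → Injective _≡_ _≡_ g
injective-resp-≗ f≗g f-inj gx≡gy = f-inj (trans (f≗g _) (trans gx≡gy (sym (f≗g _))))

Refines : ∀ {N} → Coloring N → Coloring N → Set
Refines c d = ∀ {x y} → c x ≡ c y → d x ≡ d y

module _ {N k} (Q : FinPoset N) (P : FinPoset k) where

  IsRainbowEmbedding : Coloring N → (Fin k → Fin N) → Set
  IsRainbowEmbedding c f = IsEmbedding P Q f × Injective _≡_ _≡_ (c ∘ f)

  rainbowEmbedding-resp-≗ : ∀ c {f g} → f ≗ g →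
                            IsRainbowEmbedding c f → IsRainbowEmbedding c g
  rainbowEmbedding-resp-≗ c {f} {g} f≗g ((f-inj , f-order) , cf-inj) =
    (injective-resp-≗ f≗g f-inj , λ x y → preserve x y , reflect x y) ,
    injective-resp-≗ (cong c ∘ f≗g) cf-inj
    where
    preserve : ∀ x y → T (le P x y) → T (le Q (g x) (g y))
    preserve x y = subst₂ (λ a b → T (le Q a b)) (f≗g x) (f≗g y) ∘ proj₁ (f-order x y)

    reflect : ∀ x y → T (le Q (g x) (g y)) → T (le P x y)
    reflect x y =
      proj₂ (f-order x y) ∘ subst₂ (λ a b → T (le Q a b)) (sym (f≗g x)) (sym (f≗g y))

  proper? : ∀ c → Dec (Proper Q c)
  proper? c = all? λ x → all? λ y →
    ¬? (x Fin.≟ y) →-dec (comparable? Q x y →-dec ¬? (c x NP.≟ c y))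

  isRainbowEmbedding? : ∀ c f → Dec (IsRainbowEmbedding c f)
  isRainbowEmbedding? c f =
    (injective? Fin._≟_ f ×-dec (all? λ x → all? λ y →
        (T? (le P x y) →-dec T? (le Q (f x) (f y))) ×-dec
        (T? (le Q (f x) (f y)) →-dec T? (le P x y))))
    ×-dec injective? NP._≟_ (c ∘ f)

  hasRainbowCopy? : ∀ c → Dec (HasRainbowCopy P Q c)
  hasRainbowCopy? c = map′ (λ (i , ok) → finToFun i , ok)
    (λ (f , ok) → funToFin f , rainbowEmbedding-resp-≗ c (sym ∘ finToFun-funToFin f) ok)
    (any? λ i → isRainbowEmbedding? c (finToFun i))

  proper-refines : ∀ {c d} → Refines c d → Proper Q d → Proper Q c
  proper-refines c⊑d d-proper x y x≢y x∼y = d-proper x y x≢y x∼y ∘ c⊑d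

  rainbow-refines : ∀ {c d} → Refines c d → HasRainbowCopy P Q d → HasRainbowCopy P Q c
  rainbow-refines c⊑d (f , f-emb , df-inj) = f , f-emb , df-inj ∘ c⊑d

  representative : Coloring N → ℕ → Fin N → Fin N
  representative c v x with any? (λ y → c y NP.≟ v)
  ... | yes (y , _) = y
  ... | no  _       = x   -- unreachable when v = c x, as in normalise

  representative-colour : ∀ (c : Coloring N) {v} x → c x ≡ v → c (representative c v x) ≡ v
  representative-colour c {v} x cx≡v with any? (λ y → c y NP.≟ v)
  ... | yes (_ , cy≡v) = cy≡v
  ... | no  _          = cx≡v

  representative-unique : ∀ (c : Coloring N) {v} x y → c x ≡ v →
                          representative c v x ≡ representative c v y
  representative-unique c {v} x y cx≡v with any? (λ y → c y NP.≟ v)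
  ... | yes _    = refl
  ... | no  none = ⊥-elim (none (x , cx≡v))

  normalise : Coloring N → Fin N → Fin N
  normalise c x = representative c (c x) x

  refines-normalise : ∀ c → Refines c (toℕ ∘ normalise c)
  refines-normalise c {x} {y} cx≡cy = cong toℕ
    (trans (representative-unique c x y refl) (cong (λ v → representative c v y) cx≡cy))

  normalise-refines : ∀ c → Refines (toℕ ∘ normalise c) c
  normalise-refines c {x} {y} nx≡ny = begin
    c x                       ≡⟨ representative-colour c x refl ⟨
    c (normalise c x)         ≡⟨ cong c (FinP.toℕ-injective nx≡ny) ⟩
    c (normalise c y)         ≡⟨ representative-colour c y refl ⟩
    c y                       ∎
    where open ≡-Reasoning

  rainbowForces? : Dec (RainbowForces Q P)
  rainbowForces? = map′ fromCodes (λ rf i → rf (code i))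
    (all? λ i → proper? (code i) →-dec hasRainbowCopy? (code i))
    where
    code : Fin (N ^ N) → Coloring N
    code i = toℕ ∘ finToFun i

    fromCodes : (∀ i → Proper Q (code i) → HasRainbowCopy P Q (code i)) → RainbowForces Q P
    fromCodes forced c c-proper =
      rainbow-refines {c} c⊑code (forced i (proper-refines code⊑c c-proper))
      where
      i = funToFin (normalise c)
      code≗normalise : code i ≗ toℕ ∘ normalise c
      code≗normalise x = cong toℕ (finToFun-funToFin (normalise c) x)
      c⊑code : Refines c (code i)
      c⊑code {x} {y} cx≡cy =
        trans (code≗normalise x) (trans (refines-normalise c cx≡cy) (sym (code≗normalise y)))
      code⊑c : Refines (code i) c
      code⊑c {x} {y} dx≡dy =
        normalise-refines c (trans (sym (code≗normalise x)) (trans dx≡dy (code≗normalise y)))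

minimal-subposet : ∀ {k} (P : FinPoset k) N (Q : FinPoset N) → RainbowForces Q P →
  Σ ℕ λ m → Σ (FinPoset m) λ Q′ → InM Q′ P × m ≤ N
minimal-subposet P zero    Q forces = zero , Q , (forces , tt) , z≤n
minimal-subposet P (suc N) Q forces with any? (λ q → rainbowForces? (Delete Q q) P)
... | yes (q , forces-q) = Product.map₂ (Product.map₂ (Product.map₂ NP.m≤n⇒m≤1+n))
                             (minimal-subposet P N (Delete Q q) forces-q)
... | no  none           = suc N , Q , (forces , λ q → none ∘ (q ,_)) , NP.≤-refl

lemma2p1 : ∀ (k : ℕ) (P : FinPoset k) →
    Σ ℕ λ m → Σ (FinPoset m) λ Q → InM Q P × m ≤ perp P
lemma2p1 k P with minimal-subposet P _ (Blowup.Q P) (Blowup.forces P)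
... | m , Q , Q∈M , m≤size =
  m , Q , Q∈M , NP.≤-trans m≤size (NP.≤-reflexive (Blowup.size≡perp P))
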